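{- Let $t$ be a term, $p=d(t)$ its depth, $k=W_1(t)$, and $n\ge 1$ an integer. Then $W_n(t)\le k\cdot n^p$.
   Context: Pseudo-terms are given by the grammar $t ::= x \mid \lambda x.t \mid (t\,t') \mid\, !t \mid \mathrm{let}\ t\ \mathrm{be}\ !x\ \mathrm{in}\ t'$, with $x$ bound in $t'$ in the let construct. $FV(t)$ is the set of free variables of $t$, and $no(x,t)$ is the number of free occurrences of $x$ in $t$. Terms and their sets of temporary variables $TV(t)\subseteq FV(t)$ are defined simultaneously as the smallest set of pseudo-terms such that: (i) a variable $x$ is a term, $TV(x)=\emptyset$; (ii) $\lambda x.t$ is a term iff $t$ is a term, $x\notin TV(t)$ and $no(x,t)\le 1$, and then $TV(\lambda x.t)=TV(t)$; (iii) $(t_1\,t_2)$ is a term iff $t_1,t_2$ are terms, $TV(t_1)\cap FV(t_2)=\emptyset$ and $FV(t_1)\cap TV(t_2)=\emptyset$, and then $TV(t_1\,t_2)=TV(t_1)\cup TV(t_2)$; (iv) $!t$ is a term iff $t$ is a term, $TV(t)=\emptyset$ and $no(x,t)=1$ for all $x\in FV(t)$, and then $TV(!t)=FV(t)$; (v) $\mathrm{let}\ t_1\ \mathrm{be}\ !x\ \mathrm{in}\ t_2$ is a term iff $t_1,t_2$ are terms, $TV(t_1)\cap FV(t_2)=\emptyset$ and $FV(t_1)\cap TV(t_2)=\emptyset$, and then its $TV$ is $TV(t_1)\cup(TV(t_2)\setminus\{x\})$. Depth: for an occurrence $u$ of a subterm of $t$, its depth in $t$ is the number of subterm occurrences $v$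 of $t$ of the form $!v'$ such that $u$ is a subterm of $v$; $d(t)$ is the maximum depth of subterm occurrences of $t$. Weight, for an integer $n$: $W_n(x)=1$, $W_n(\lambda x.t)=W_n(t)+1$, $W_n(!u)=n\,W_n(u)+1$, $W_n(t_1\,t_2)=W_n(t_1)+W_n(t_2)$, $W_n(\mathrm{let}\ u\ \mathrm{be}\ !x\ \mathrm{in}\ t_1)=W_n(u)+W_n(t_1)$. -}

module Defs where

open import Data.Nat using (ℕ; zero; suc; _+_; _*_; _⊔_; _≡ᵇ_; _≤_; _^_)
open import Data.Bool using (if_then_else_)
open import Data.List using (List; []; _∷_; _++_; filter)
open import Data.List.Membership.Propositional using (_∈_; _∉_)
open import Relation.Nullary using (¬_)
open import Relation.Nullary.Decidable using (¬?)
open import Relation.Binary.PropositionalEquality using (_≡_)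
open import Data.Product using (_×_; Σ)
open import Data.Nat using (_≟_)

Var : Set
Var = ℕ

data PTm : Set where
  var  : Var → PTm
  lam  : Var → PTm → PTm
  app  : PTm → PTm → PTm
  bang : PTm → PTm
  letb : PTm → Var → PTm → PTm   -- let t₁ be !x in t₂ (x bound in t₂)

remove : Var → List Var → List Var
remove x = filter (λ y → ¬? (y ≟ x))

FV : PTm → List Var
FV (var x)       = x ∷ []
FV (lam x t)     = remove x (FV t)
FV (app t u)     = FV t ++ FV u
FV (bang t)      = FV t
FV (letb t x u)  = FV t ++ remove x (FV u)

no : Var → PTm → ℕ
no x (var y)      = if x ≡ᵇ y then 1 else 0
no x (lam y t)    = if x ≡ᵇ y then 0 else no x t
no x (app t u)    = no x t + no x u
no x (bang t)     = no x t
no x (letb t y u) = no x t + (if x ≡ᵇ y then 0 else no x u)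

Disjoint : List Var → List Var → Set
Disjoint A B = ∀ {y} → y ∈ A → y ∉ B

-- IsTerm t T : t is a term and TV(t) = T (T as a list, set semantics)
data IsTerm : PTm → List Var → Set where
  tvar  : ∀ x → IsTerm (var x) []
  tlam  : ∀ {x t T} → IsTerm t T → x ∉ T → no x t ≤ 1
        → IsTerm (lam x t) T
  tapp  : ∀ {t₁ t₂ T₁ T₂} → IsTerm t₁ T₁ → IsTerm t₂ T₂
        → Disjoint T₁ (FV t₂) → Disjoint (FV t₁) T₂
        → IsTerm (app t₁ t₂) (T₁ ++ T₂)
  tbang : ∀ {t} → IsTerm t [] → (∀ {x} → x ∈ FV t → no x t ≡ 1)
        → IsTerm (bang t) (FV t)
  tlet  : ∀ {t₁ t₂ x T₁ T₂} → IsTerm t₁ T₁ → IsTerm t₂ T₂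
        → Disjoint T₁ (FV t₂) → Disjoint (FV t₁) T₂
        → IsTerm (letb t₁ x t₂) (T₁ ++ remove x T₂)

Term : PTm → Set
Term t = Σ (List Var) (IsTerm t)

depth : PTm → ℕ
depth (var x)      = 0
depth (lam x t)    = depth t
depth (app t u)    = depth t ⊔ depth u
depth (bang t)     = suc (depth t)
depth (letb t x u) = depth t ⊔ depth u

W : ℕ → PTm → ℕ
W n (var x)      = 1
W n (lam x t)    = W n t + 1
W n (bang u)     = n * W n u + 1
W n (app t u)    = W n t + W n u
W n (letb u x t) = W n u + W n t

{-# OPTIONS --safe #-}
module Submission where

open import Defs
open import Data.Nat using (ℕ; suc; s≤s; _+_; _*_; _^_; _≤_; NonZero; >-nonZero)
open import Data.Nat.Properties
open import Algebra.Properties.CommutativeSemigroup *-commutativeSemigroup using (x∙yz≈y∙xz)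
open import Relation.Binary.PropositionalEquality using (sym; cong; subst)

-- A symbol at depth i counts n ^ i in W n and 1 in W 1, and i ≤ d(t).  The induction
-- carries an upper bound d on the depth, since the two halves of an application or a
-- let may have different depths.

+-≤-*-distribʳ : ∀ c e m {a b} → a ≤ c * m → b ≤ e * m → a + b ≤ (c + e) * m
+-≤-*-distribʳ c e m {a} {b} a≤cm b≤em =
  subst (a + b ≤_) (sym (*-distribʳ-+ m c e)) (+-mono-≤ a≤cm b≤em)

1≤1*n^d : ∀ n .{{_ : NonZero n}} d → 1 ≤ 1 * n ^ d
1≤1*n^d n d = subst (1 ≤_) (sym (*-identityˡ (n ^ d))) (m^n>0 n d)

Wₙ≤W₁*n^d : ∀ n .{{_ : NonZero n}} t d → depth t ≤ d → W n t ≤ W 1 t * n ^ d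
Wₙ≤W₁*n^d n (var x) d _ = 1≤1*n^d n d
Wₙ≤W₁*n^d n (lam x t) d t≤d =
  +-≤-*-distribʳ (W 1 t) 1 (n ^ d) (Wₙ≤W₁*n^d n t d t≤d) (1≤1*n^d n d)
Wₙ≤W₁*n^d n (app t u) d t⊔u≤d =
  +-≤-*-distribʳ (W 1 t) (W 1 u) (n ^ d)
    (Wₙ≤W₁*n^d n t d (m⊔n≤o⇒m≤o _ _ t⊔u≤d))
    (Wₙ≤W₁*n^d n u d (m⊔n≤o⇒n≤o _ _ t⊔u≤d))
Wₙ≤W₁*n^d n (letb t x u) d t⊔u≤d =
  +-≤-*-distribʳ (W 1 t) (W 1 u) (n ^ d)
    (Wₙ≤W₁*n^d n t d (m⊔n≤o⇒m≤o _ _ t⊔u≤d))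
    (Wₙ≤W₁*n^d n u d (m⊔n≤o⇒n≤o _ _ t⊔u≤d))
Wₙ≤W₁*n^d n (bang t) (suc d) (s≤s t≤d) =
  +-≤-*-distribʳ (1 * W 1 t) 1 (n ^ suc d) body (1≤1*n^d n (suc d))
  where
  open ≤-Reasoning
  body : n * W n t ≤ 1 * W 1 t * n ^ suc d
  body = begin
    n * W n t              ≤⟨ *-monoʳ-≤ n (Wₙ≤W₁*n^d n t d t≤d) ⟩
    n * (W 1 t * n ^ d)    ≡⟨ x∙yz≈y∙xz n (W 1 t) (n ^ d) ⟩
    W 1 t * n ^ suc d      ≡⟨ cong (_* n ^ suc d) (sym (*-identityˡ (W 1 t))) ⟩
    1 * W 1 t * n ^ suc d  ∎

mainTheorem18 : (t : PTm) → Term t → (n : ℕ) → 1 ≤ n →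
    W n t ≤ W 1 t * n ^ depth t
mainTheorem18 t _ n 1≤n = Wₙ≤W₁*n^d n {{>-nonZero 1≤n}} t (depth t) ≤-refl
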